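{- Let $\Pi$ be an active membrane system without charges and without dissolution rules (as defined in the context). Let $\mathcal{C}_i$ be a configuration of $\Pi$ containing an instance of an object $o$ in a membrane with label $h$. Let $\mathcal{C}^{\emptyset}_i$ be the configuration obtained from $\mathcal{C}_i$ by removing all objects other than this instance of $o$ (membrane structure and labels unchanged). If there is a rule $r$ of $\Pi$ such that applying $r$ to this $o$ in $h$ in $\mathcal{C}^{\emptyset}_i$ gives a configuration $\mathcal{C}^{\emptyset}_{i+1}$ containing an object $o'$ in a membrane with label $h'$, then there exists a configuration $\mathcal{C}_{i+1}$, reachable from $\mathcal{C}_i$ in a single (maximally parallel) step, that contains $o'$ in a membrane with label $h'$.
   Context: An active membrane system without charges and without dissolution is a tuple $\Pi=(O,\mu,M,H,\Lambda,R)$ where $O$ is a finite alphabet of objects; $\mu=(V_\mu,E_\mu,env)$ is a finite rooted tree of membranes (the root $env$ is the environment, $(p,c)\in E_\mu$ means membrane $p$ contains membrane $c$; leaves are elementary membranes); $M$ assigns to each membrane a finite multiset of objects; $\Lambda:V_\mu\to H$ assigns labels from a finite label set $H$ (initially injective; the environment has label $env$); and $R$ is a finite set of rules of the following types, with $o,u,v\in O$, $w$ a multiset over $O$, $h\in H$: (a) $[o\to w]_h$: an object $o$ in a membrane labelled $h$ is replaced by $w$; (b) $o[\,]_h\to[u]_h$: an object $o$ in a membrane having a child labelled $h$ moves into that child and becomes $u$; (c) $[o]_h\to[\,]_h u$: an object $o$ in a membrane labelled $h$ moves to the parent membrane and becomes $u$; (e) $[o]_h\to[u]_h[v]_h$: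 an elementary membrane labelled $h$ containing $o$ is duplicated, with $o$ replaced by $u$ in one copy and by $v$ in the other. The environment cannot divide or send objects out. A configuration is a triple (membrane tree, contents map, labelling map), the labelling possibly non-injective. A step (transition) applies a non-deterministically chosen maximal multiset of applicable rules, subject to: each object is involved in at most one rule; each membrane is the subject of at most one rule of type (b), (c) or (e); rules are applied to the most deeply nested membranes first; if a membrane divides, type (a) rules on its objects are applied first and then the division. -}

module Defs where

open import Data.Nat using (ℕ; zero; suc; _+_; _≤_; _≡ᵇ_)
open import Data.Fin using (Fin)
open import Data.Bool using (Bool; true; false; if_then_else_)
open import Data.List using (List; []; _∷_; _++_; map)
open import Data.List.Membership.Propositional using (_∈_)
open import Data.List.Relation.Unary.All using (All)
open import Data.List.Relation.Unary.Any using (Any)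
open import Data.Maybe using (Maybe; just; nothing)
open import Data.Product using (_×_; _,_; proj₁; proj₂; ∃)
open import Data.Unit using (⊤)
open import Relation.Binary.PropositionalEquality using (_≡_)
open import Relation.Nullary using (¬_)

data Rule (O H : Set) : Set where
  evo  : O → List O → H → Rule O H      -- (a) [o → w]_h
  inR  : O → O → H → Rule O H           -- (b) o [ ]_h → [u]_h
  outR : O → O → H → Rule O H           -- (c) [o]_h → [ ]_h u
  divR : O → O → O → H → Rule O H       -- (e) [o]_h → [u]_h [v]_h

record System : Set where
  field
    nO    : ℕ
    nH    : ℕ
    env   : Fin nH
    rules : List (Rule (Fin nO) (Fin nH))

data OneAt {A : Set} (R : A → A → Set) : List A → List A → Set where
  here  : ∀ {x y xs} → R x y → OneAt R (x ∷ xs) (y ∷ xs)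
  there : ∀ {x xs ys} → OneAt R xs ys → OneAt R (x ∷ xs) (x ∷ ys)

nth : {A : Set} → ℕ → List A → Maybe A
nth _       []       = nothing
nth zero    (x ∷ xs) = just x
nth (suc n) (x ∷ xs) = nth n xs

module Sem (Π : System) where
  open System Π

  O : Set
  O = Fin nO

  H : Set
  H = Fin nH

  R : Set
  R = Rule O H

  -- A configuration: a rooted tree of membranes; each node carries its
  -- label (possibly non-injective) and its contents (a multiset, as a list).
  -- The root is the environment.
  data Mem : Set where
    mem : H → List O → List Mem → Mem

  label : Mem → H
  label (mem h _ _) = h

  data Contains : Mem → O → H → Set where
    here  : ∀ {h os cs o} → o ∈ os → Contains (mem h os cs) o h
    there : ∀ {h g os cs o} → Any (λ c → Contains c o h) cs → Contains (mem g os cs) o h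

  nodeAt : List ℕ → Mem → Maybe Mem
  nodeAt []      m             = just m
  nodeAt (j ∷ p) (mem _ _ cs)  with nth j cs
  ... | just c  = nodeAt p c
  ... | nothing = nothing

  OccursAt : Mem → List ℕ → O → H → Set
  OccursAt C p o h = ∃ λ os → ∃ λ cs → nodeAt p C ≡ just (mem h os cs) × o ∈ os

  mutual
    clear : Mem → Mem
    clear (mem h _ cs) = mem h [] (clearList cs)

    clearList : List Mem → List Mem
    clearList []       = []
    clearList (c ∷ cs) = clear c ∷ clearList cs

  mutual
    strip : List ℕ → O → Mem → Mem
    strip []      o (mem h _ cs) = mem h (o ∷ []) (clearList cs)
    strip (j ∷ p) o (mem h _ cs) = mem h [] (stripAt j p o cs)

    stripAt : ℕ → List ℕ → O → List Mem → List Mem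
    stripAt _       _ _ []       = []
    stripAt zero    p o (c ∷ cs) = strip p o c ∷ clearList cs
    stripAt (suc j) p o (c ∷ cs) = clear c ∷ stripAt j p o cs

  -- What an object does in a step: nothing, or is the object of rule r
  -- (the index j selects the target child for a type (b) rule; ignored otherwise).
  data Act : Set where
    idle : Act
    use  : R → ℕ → Act

  -- A configuration annotated with the chosen multiset of rule applications.
  data AMem : Set where
    amem : H → List (O × Act) → List AMem → AMem

  mutual
    erase : AMem → Mem
    erase (amem h xs cs) = mem h (map proj₁ xs) (eraseList cs)

    eraseList : List AMem → List Mem
    eraseList []       = []
    eraseList (c ∷ cs) = erase c ∷ eraseList cs

  labelA : AMem → H
  labelA (amem h _ _) = h

  objOf : R → O
  objOf (evo o _ _)    = o
  objOf (inR o _ _)    = o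
  objOf (outR o _ _)   = o
  objOf (divR o _ _ _) = o

  -- applicability of rule r to an object of a membrane labelled h with
  -- (annotated) children cs; rt = is this membrane the environment
  RuleOK : Bool → H → List AMem → R → ℕ → Set
  RuleOK rt h cs (evo _ _ h')    j = h' ≡ h
  RuleOK rt h cs (inR _ _ h')    j = ∃ λ c → nth j cs ≡ just c × labelA c ≡ h'
  RuleOK rt h cs (outR _ _ h')   j = h' ≡ h × rt ≡ false
  RuleOK rt h cs (divR _ _ _ h') j = h' ≡ h × rt ≡ false × cs ≡ []

  ActOK : Bool → H → List AMem → O × Act → Set
  ActOK rt h cs (o , idle)    = ⊤
  ActOK rt h cs (o , use r j) = r ∈ rules × objOf r ≡ o × RuleOK rt h cs r j

  nIn : ℕ → List (O × Act) → ℕ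
  nIn j []                          = 0
  nIn j ((_ , use (inR _ _ _) k) ∷ xs) = (if j ≡ᵇ k then 1 else 0) + nIn j xs
  nIn j (_ ∷ xs)                    = nIn j xs

  nOwn : List (O × Act) → ℕ
  nOwn []                               = 0
  nOwn ((_ , use (outR _ _ _) _) ∷ xs)   = suc (nOwn xs)
  nOwn ((_ , use (divR _ _ _ _) _) ∷ xs) = suc (nOwn xs)
  nOwn (_ ∷ xs)                         = nOwn xs

  subj : AMem → ℕ
  subj (amem _ ys _) = nOwn ys

  -- validity of a multiset of rule applications: each object in at most one
  -- rule (built in), each used rule applicable, and each membrane the subject
  -- of at most one rule of type (b), (c), (e).  The environment cannot
  -- send objects out or divide.
  mutual
    Valid : Bool → AMem → Set
    Valid rt (amem h xs cs) = All (ActOK rt h cs) xs × ValidCs xs 0 cs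

    ValidCs : List (O × Act) → ℕ → List AMem → Set
    ValidCs xs j []       = ⊤
    ValidCs xs j (c ∷ cs) = (nIn j xs + subj c ≤ 1) × Valid false c × ValidCs xs (suc j) cs

  data Activate : O × Act → O × Act → Set where
    act : ∀ {o} r j → Activate (o , idle) (o , use r j)

  data Extends : AMem → AMem → Set where
    here  : ∀ {h xs ys cs} → OneAt Activate xs ys → Extends (amem h xs cs) (amem h ys cs)
    there : ∀ {h xs cs ds} → OneAt Extends cs ds → Extends (amem h xs cs) (amem h xs ds)

  Maximal : AMem → Set
  Maximal a = ∀ a' → Extends a a' → ¬ Valid true a'

  evolved : List (O × Act) → List O
  evolved []                             = []
  evolved ((o , idle) ∷ xs)              = o ∷ evolved xs
  evolved ((_ , use (evo _ w _) _) ∷ xs) = w ++ evolved xs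
  evolved (_ ∷ xs)                       = evolved xs

  incoming : ℕ → List (O × Act) → List O
  incoming j []                             = []
  incoming j ((_ , use (inR _ u _) k) ∷ xs) = (if j ≡ᵇ k then u ∷ [] else []) ++ incoming j xs
  incoming j (_ ∷ xs)                       = incoming j xs

  outs : List (O × Act) → List O
  outs []                              = []
  outs ((_ , use (outR _ u _) _) ∷ xs) = u ∷ outs xs
  outs (_ ∷ xs)                        = outs xs

  divOf : List (O × Act) → Maybe (O × O)
  divOf []                                = nothing
  divOf ((_ , use (divR _ u v _) _) ∷ xs) = just (u , v)
  divOf (_ ∷ xs)                          = divOf xs

  -- apply inc a: the membranes replacing a (one, or two after division)
  -- and the objects sent out of a; inc = objects entering a from its parent.
  -- Type (a) rules in a dividing membrane act first; both copies get the result.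
  mutual
    apply : List O → AMem → List Mem × List O
    apply inc (amem h xs cs) with applyCs xs 0 cs | divOf xs
    ... | (cs' , ups) | just (u , v) =
          (mem h (u ∷ evolved xs ++ ups ++ inc) cs' ∷ mem h (v ∷ evolved xs ++ ups ++ inc) cs' ∷ [] , outs xs)
    ... | (cs' , ups) | nothing = (mem h (evolved xs ++ ups ++ inc) cs' ∷ [] , outs xs)

    applyCs : List (O × Act) → ℕ → List AMem → List Mem × List O
    applyCs xs j []       = ([] , [])
    applyCs xs j (c ∷ cs) with apply (incoming j xs) c | applyCs xs (suc j) cs
    ... | (ms , us) | (ms' , us') = (ms ++ ms' , us ++ us')

  Step : Mem → Mem → Set
  Step C C' = ∃ λ a → erase a ≡ C × Valid true a × Maximal a × proj₁ (apply [] a) ≡ C' ∷ []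

  mutual
    mark : Act → Mem → AMem
    mark t (mem h os cs) = amem h (map (λ o → (o , t)) os) (markList t cs)

    markList : Act → List Mem → List AMem
    markList t []       = []
    markList t (c ∷ cs) = mark t c ∷ markList t cs

  ApplyRule : R → ℕ → Mem → Mem → Set
  ApplyRule r j D D' = Valid true (mark (use r j) D) × proj₁ (apply [] (mark (use r j) D)) ≡ D' ∷ []

module Submission where

-- A step is an annotation of C marking every object idle or with the rule it
-- performs; let t be "apply r with target child j".
--  * Annotate C with t on the chosen instance of o, idle elsewhere.  This is
--    the valid annotation of the stripped configuration with idle objects
--    added, and validity is invariant under relations that preserve the rule
--    counts and applicability (module Invariance), so it is valid.
--  * Validity is decidable, and a finite list of candidate activations covers
--    every valid activation up to the irrelevant target of non-(b) rules.  As
--    activation lowers the number of idle objects, the generic MaximalSearch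
--    reaches a maximal valid annotation a*, which still erases to C.
--  * The environment never divides, so a* yields a single configuration C'.
--  * Applying annotations is monotone (apply-mono): if every active object of
--    one annotation occurs in the other, the membranes produced by the first
--    embed into those of the second.  Embeddings preserve containment, so o'
--    in h' passes from the stripped result to C'.

open import Defs
open import Data.Nat using (ℕ; zero; suc; _+_; _≤_; _<_; _≤?_; z≤n; s≤s; _≡ᵇ_)
import Data.Nat as ℕ
open import Data.Nat.Properties using (≤-refl; ≤-trans; ≤-pred; n≮0; m+n≤o⇒n≤o; +-monoˡ-<; +-monoʳ-<)
open import Data.Nat.Induction using (<-wellFounded)
open import Data.Fin using () renaming (_≟_ to _≟F_)
open import Data.Bool using (true; false; if_then_else_) renaming (_≟_ to _≟B_)
open import Data.List using (List; []; _∷_; _++_; map; concatMap; length; upTo)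
open import Data.List.Properties using (map-∘; map-id) renaming (≡-dec to List-≡-dec)
open import Data.List.Membership.Propositional using (_∈_; lose; find)
open import Data.List.Membership.Propositional.Properties using (∈-map⁺; ∈-map⁻; ∈-++⁺ˡ; ∈-++⁺ʳ; ∈-++⁻; ∈-upTo⁺; ∈-concatMap⁺; ∈-concatMap⁻)
import Data.List.Membership.DecPropositional as DecMembership
open import Data.List.Relation.Binary.Subset.Propositional using (_⊆_)
open import Data.List.Relation.Binary.Subset.Propositional.Properties using (++⁺; concatMap⁺)
open import Data.List.Relation.Unary.All as All using (All; []; _∷_; all?)
open import Data.List.Relation.Unary.Any as Any using (Any; here; there; any?)
open import Data.Maybe using (Maybe; just; nothing)
open import Data.Product using (∃; _×_; _,_; proj₁; proj₂)
open import Data.Product.Properties using () renaming (≡-dec to ×-≡-dec)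
open import Data.Sum using (_⊎_; inj₁; inj₂)
open import Data.Unit using (tt)
open import Data.Empty using (⊥-elim)
open import Function using (_on_)
open import Induction.WellFounded using (Acc; acc)
open import Relation.Binary.Construct.On as On using ()
open import Relation.Binary.Construct.Closure.ReflexiveTransitive using (Star; ε; _◅_)
open import Relation.Binary.Definitions using (DecidableEquality)
open import Relation.Binary.PropositionalEquality using (_≡_; refl; sym; trans; cong; cong₂; subst; subst₂)
open import Relation.Nullary using (Dec; yes; no; ¬_)
open import Relation.Nullary.Decidable using (_×-dec_; map′)

module MaximalSearch {A : Set} (_⇝_ : A → A → Set) (P : A → Set) (μ : A → ℕ)
  (decreasing : ∀ {a b} → a ⇝ b → μ b < μ a)
  (step? : ∀ a → (∃ λ b → a ⇝ b × P b) ⊎ (∀ b → a ⇝ b → ¬ P b)) where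

  maximal-above : ∀ a → P a → ∃ λ b → Star _⇝_ a b × P b × (∀ b' → b ⇝ b' → ¬ P b')
  maximal-above a = search a (On.wellFounded μ <-wellFounded a)
    where
      search : ∀ a → Acc (_<_ on μ) a → P a → ∃ λ b → Star _⇝_ a b × P b × (∀ b' → b ⇝ b' → ¬ P b')
      search a (acc smaller) pa with step? a
      ... | inj₂ stuck = a , ε , pa , stuck
      ... | inj₁ (b , a⇝b , pb) =
        let (c , b⇝*c , pc , stuck) = search b (smaller (decreasing a⇝b)) pb
        in c , a⇝b ◅ b⇝*c , pc , stuck

module Development (Π : System) where
  open System Π
  open Sem Π

  AObj : Set
  AObj = O × Act

  tag : Act → O → AObj
  tag t x = x , t

  data Active : AObj → Set where
    active : ∀ {o r j} → Active (o , use r j)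

  evolvedBy : AObj → List O
  evolvedBy (o , idle)              = o ∷ []
  evolvedBy (_ , use (evo _ w _) _) = w
  evolvedBy (_ , use _ _)           = []

  incomingBy : ℕ → AObj → List O
  incomingBy j (_ , use (inR _ u _) k) = if j ≡ᵇ k then u ∷ [] else []
  incomingBy j _                       = []

  outBy : AObj → List O
  outBy (_ , use (outR _ u _) _) = u ∷ []
  outBy _                        = []

  evolved-concatMap : ∀ xs → evolved xs ≡ concatMap evolvedBy xs
  evolved-concatMap []                                  = refl
  evolved-concatMap ((o , idle) ∷ xs)                   = cong (o ∷_) (evolved-concatMap xs)
  evolved-concatMap ((_ , use (evo _ w _) _) ∷ xs)      = cong (w ++_) (evolved-concatMap xs)
  evolved-concatMap ((_ , use (inR _ _ _) _) ∷ xs)      = evolved-concatMap xs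
  evolved-concatMap ((_ , use (outR _ _ _) _) ∷ xs)     = evolved-concatMap xs
  evolved-concatMap ((_ , use (divR _ _ _ _) _) ∷ xs)   = evolved-concatMap xs

  incoming-concatMap : ∀ j xs → incoming j xs ≡ concatMap (incomingBy j) xs
  incoming-concatMap j []                                = refl
  incoming-concatMap j ((_ , idle) ∷ xs)                 = incoming-concatMap j xs
  incoming-concatMap j ((_ , use (evo _ _ _) _) ∷ xs)    = incoming-concatMap j xs
  incoming-concatMap j ((_ , use (inR _ u _) k) ∷ xs)    =
    cong ((if j ≡ᵇ k then u ∷ [] else []) ++_) (incoming-concatMap j xs)
  incoming-concatMap j ((_ , use (outR _ _ _) _) ∷ xs)   = incoming-concatMap j xs
  incoming-concatMap j ((_ , use (divR _ _ _ _) _) ∷ xs) = incoming-concatMap j xs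

  outs-concatMap : ∀ xs → outs xs ≡ concatMap outBy xs
  outs-concatMap []                                = refl
  outs-concatMap ((_ , idle) ∷ xs)                 = outs-concatMap xs
  outs-concatMap ((_ , use (evo _ _ _) _) ∷ xs)    = outs-concatMap xs
  outs-concatMap ((_ , use (inR _ _ _) _) ∷ xs)    = outs-concatMap xs
  outs-concatMap ((_ , use (outR _ u _) _) ∷ xs)   = cong (u ∷_) (outs-concatMap xs)
  outs-concatMap ((_ , use (divR _ _ _ _) _) ∷ xs) = outs-concatMap xs

  objectwise-mono : ∀ {F : List AObj → List O} f → (∀ xs → F xs ≡ concatMap f xs) →
                    ∀ {xs ys} → xs ⊆ ys → F xs ⊆ F ys
  objectwise-mono f F≡ {xs} {ys} xs⊆ys = subst₂ _⊆_ (sym (F≡ xs)) (sym (F≡ ys)) (concatMap⁺ f xs⊆ys)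

  nIn-cons : ∀ j x {xs ys} → nIn j xs ≡ nIn j ys → nIn j (x ∷ xs) ≡ nIn j (x ∷ ys)
  nIn-cons j (_ , idle)                 eq = eq
  nIn-cons j (_ , use (evo _ _ _) _)    eq = eq
  nIn-cons j (_ , use (inR _ _ _) k)    eq = cong ((if j ≡ᵇ k then 1 else 0) +_) eq
  nIn-cons j (_ , use (outR _ _ _) _)   eq = eq
  nIn-cons j (_ , use (divR _ _ _ _) _) eq = eq

  nOwn-cons : ∀ x {xs ys} → nOwn xs ≡ nOwn ys → nOwn (x ∷ xs) ≡ nOwn (x ∷ ys)
  nOwn-cons (_ , idle)                 eq = eq
  nOwn-cons (_ , use (evo _ _ _) _)    eq = eq
  nOwn-cons (_ , use (inR _ _ _) _)    eq = eq
  nOwn-cons (_ , use (outR _ _ _) _)   eq = cong suc eq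
  nOwn-cons (_ , use (divR _ _ _ _) _) eq = cong suc eq

  mutual
    data Lift (RX : List AObj → List AObj → Set) : AMem → AMem → Set where
      node : ∀ {h xs ys cs ds} → RX xs ys → LiftAll RX cs ds → Lift RX (amem h xs cs) (amem h ys ds)

    data LiftAll (RX : List AObj → List AObj → Set) : List AMem → List AMem → Set where
      []  : LiftAll RX [] []
      _∷_ : ∀ {c d cs ds} → Lift RX c d → LiftAll RX cs ds → LiftAll RX (c ∷ cs) (d ∷ ds)

  mutual
    Lift-map : ∀ {RX RY} → (∀ {xs ys} → RX xs ys → RY xs ys) → ∀ {a b} → Lift RX a b → Lift RY a b
    Lift-map f (node rx ts) = node (f rx) (LiftAll-map f ts)

    LiftAll-map : ∀ {RX RY} → (∀ {xs ys} → RX xs ys → RY xs ys) → ∀ {cs ds} → LiftAll RX cs ds → LiftAll RY cs ds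
    LiftAll-map f []       = []
    LiftAll-map f (t ∷ ts) = Lift-map f t ∷ LiftAll-map f ts

  LiftAll-nth : ∀ {RX cs ds c} j → LiftAll RX cs ds → nth j cs ≡ just c → ∃ λ d → nth j ds ≡ just d × Lift RX c d
  LiftAll-nth zero    (t ∷ ts) refl = _ , refl , t
  LiftAll-nth (suc j) (t ∷ ts) eq   = LiftAll-nth j ts eq

  Lift-label : ∀ {RX c d} → Lift RX c d → labelA c ≡ labelA d
  Lift-label (node _ _) = refl

  -- Applicability of an action only looks at the labels of the children.
  ruleOK-lift : ∀ {RX rt h cs ds} r j → LiftAll RX cs ds → RuleOK rt h cs r j → RuleOK rt h ds r j
  ruleOK-lift (evo _ _ _)    j ts ok           = ok
  ruleOK-lift (inR _ _ _)    j ts (c , at , l) =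
    let (d , at' , t) = LiftAll-nth j ts at in d , at' , trans (sym (Lift-label t)) l
  ruleOK-lift (outR _ _ _)   j ts ok           = ok
  ruleOK-lift (divR _ _ _ _) j [] ok           = ok

  actOK-lift : ∀ {RX rt h cs ds} → LiftAll RX cs ds → ∀ {x} → ActOK rt h cs x → ActOK rt h ds x
  actOK-lift ts {_ , idle}    ok                   = tt
  actOK-lift ts {_ , use r j} (r∈ , obj , applies) = r∈ , obj , ruleOK-lift r j ts applies

  -- Validity depends on an object list only through the counts nIn j, nOwn and
  -- the applicability of each action, so a relation preserving these three
  -- transports validity along whole trees.
  module Invariance (RX : List AObj → List AObj → Set)
    (same-nIn   : ∀ {xs ys} → RX xs ys → ∀ j → nIn j xs ≡ nIn j ys)
    (same-nOwn  : ∀ {xs ys} → RX xs ys → nOwn xs ≡ nOwn ys)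
    (actions-ok : ∀ {rt h cs xs ys} → RX xs ys → All (ActOK rt h cs) xs → All (ActOK rt h cs) ys) where
    mutual
      valid : ∀ {rt a b} → Lift RX a b → Valid rt a → Valid rt b
      valid (node rx ts) (acts , children) = All.map (actOK-lift ts) (actions-ok rx acts) , valid-children rx ts children

      valid-children : ∀ {xs ys j cs ds} → RX xs ys → LiftAll RX cs ds → ValidCs xs j cs → ValidCs ys j ds
      valid-children rx [] tt = tt
      valid-children {j = j} rx (t@(node rx' _) ∷ ts) (bound , v , vs) =
        subst₂ (λ a b → a + b ≤ 1) (same-nIn rx j) (same-nOwn rx') bound , valid t v , valid-children rx ts vs

  data AddIdle : List AObj → List AObj → Set where
    []   : AddIdle [] []
    keep : ∀ {x xs ys} → AddIdle xs ys → AddIdle (x ∷ xs) (x ∷ ys)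
    skip : ∀ {o xs ys} → AddIdle xs ys → AddIdle xs ((o , idle) ∷ ys)

  AddIdle-⊆ : ∀ {xs ys} → AddIdle xs ys → xs ⊆ ys
  AddIdle-⊆ (keep d) (here refl) = here refl
  AddIdle-⊆ (keep d) (there x∈)  = there (AddIdle-⊆ d x∈)
  AddIdle-⊆ (skip d) x∈          = there (AddIdle-⊆ d x∈)

  module AddIdleInvariance where
    same-nIn : ∀ {xs ys} → AddIdle xs ys → ∀ j → nIn j xs ≡ nIn j ys
    same-nIn []           j = refl
    same-nIn (keep {x} d) j = nIn-cons j x (same-nIn d j)
    same-nIn (skip d)     j = same-nIn d j

    same-nOwn : ∀ {xs ys} → AddIdle xs ys → nOwn xs ≡ nOwn ys
    same-nOwn []           = refl
    same-nOwn (keep {x} d) = nOwn-cons x (same-nOwn d)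
    same-nOwn (skip d)     = same-nOwn d

    actions-ok : ∀ {rt h cs xs ys} → AddIdle xs ys → All (ActOK rt h cs) xs → All (ActOK rt h cs) ys
    actions-ok []       oks        = oks
    actions-ok (keep d) (ok ∷ oks) = ok ∷ actions-ok d oks
    actions-ok (skip d) oks        = tt ∷ actions-ok d oks

    open Invariance AddIdle same-nIn same-nOwn actions-ok public

  -- The target index of a rule only matters for type (b) rules.
  data TargetIrrelevant : R → Set where
    evo-irr  : ∀ {o w h} → TargetIrrelevant (evo o w h)
    outR-irr : ∀ {o u h} → TargetIrrelevant (outR o u h)
    divR-irr : ∀ {o u v h} → TargetIrrelevant (divR o u v h)

  data SameEffect : AObj → AObj → Set where
    same     : ∀ {x} → SameEffect x x
    retarget : ∀ {o r j k} → TargetIrrelevant r → SameEffect (o , use r j) (o , use r k)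

  data Retarget : List AObj → List AObj → Set where
    []  : Retarget [] []
    _∷_ : ∀ {x y xs ys} → SameEffect x y → Retarget xs ys → Retarget (x ∷ xs) (y ∷ ys)

  Retarget-refl : ∀ xs → Retarget xs xs
  Retarget-refl []       = []
  Retarget-refl (x ∷ xs) = same ∷ Retarget-refl xs

  mutual
    Lift-refl : ∀ a → Lift Retarget a a
    Lift-refl (amem h xs cs) = node (Retarget-refl xs) (LiftAll-refl cs)

    LiftAll-refl : ∀ cs → LiftAll Retarget cs cs
    LiftAll-refl []       = []
    LiftAll-refl (c ∷ cs) = Lift-refl c ∷ LiftAll-refl cs

  module RetargetInvariance where
    same-nIn : ∀ {xs ys} → Retarget xs ys → ∀ j → nIn j xs ≡ nIn j ys
    same-nIn []                       j = refl
    same-nIn (same {x} ∷ rs)          j = nIn-cons j x (same-nIn rs j)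
    same-nIn (retarget evo-irr ∷ rs)  j = same-nIn rs j
    same-nIn (retarget outR-irr ∷ rs) j = same-nIn rs j
    same-nIn (retarget divR-irr ∷ rs) j = same-nIn rs j

    same-nOwn : ∀ {xs ys} → Retarget xs ys → nOwn xs ≡ nOwn ys
    same-nOwn []                       = refl
    same-nOwn (same {x} ∷ rs)          = nOwn-cons x (same-nOwn rs)
    same-nOwn (retarget evo-irr ∷ rs)  = same-nOwn rs
    same-nOwn (retarget outR-irr ∷ rs) = cong suc (same-nOwn rs)
    same-nOwn (retarget divR-irr ∷ rs) = cong suc (same-nOwn rs)

    same-ok : ∀ {rt h cs x y} → SameEffect x y → ActOK rt h cs x → ActOK rt h cs y
    same-ok same                ok = ok
    same-ok (retarget evo-irr)  ok = ok
    same-ok (retarget outR-irr) ok = ok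
    same-ok (retarget divR-irr) ok = ok

    actions-ok : ∀ {rt h cs xs ys} → Retarget xs ys → All (ActOK rt h cs) xs → All (ActOK rt h cs) ys
    actions-ok []       oks        = oks
    actions-ok (s ∷ rs) (ok ∷ oks) = same-ok s ok ∷ actions-ok rs oks

    open Invariance Retarget same-nIn same-nOwn actions-ok public

  -- Rules are coded injectively as tuples over types with decidable equality.
  Code : Set
  Code = ℕ × O × List O × O × O × H

  encode : R → Code
  encode (evo o w h)    = 0 , o , w , o , o , h
  encode (inR o u h)    = 1 , o , [] , u , u , h
  encode (outR o u h)   = 2 , o , [] , u , u , h
  encode (divR o u v h) = 3 , o , [] , u , v , h

  decode : Code → R
  decode (0 , o , w , _ , _ , h) = evo o w h
  decode (1 , o , _ , u , _ , h) = inR o u h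
  decode (2 , o , _ , u , _ , h) = outR o u h
  decode (_ , o , _ , u , v , h) = divR o u v h

  decode-encode : ∀ r → decode (encode r) ≡ r
  decode-encode (evo _ _ _)    = refl
  decode-encode (inR _ _ _)    = refl
  decode-encode (outR _ _ _)   = refl
  decode-encode (divR _ _ _ _) = refl

  _≟R_ : DecidableEquality R
  r ≟R s = map′ (λ eq → trans (sym (decode-encode r)) (trans (cong decode eq) (decode-encode s)))
                (cong encode) (encode r ≟Code encode s)
    where
      _≟Code_ : DecidableEquality Code
      _≟Code_ = ×-≡-dec ℕ._≟_ (×-≡-dec _≟F_ (×-≡-dec (List-≡-dec _≟F_) (×-≡-dec _≟F_ (×-≡-dec _≟F_ _≟F_))))

  open DecMembership _≟R_ using (_∈?_)

  ruleOK? : ∀ rt h cs r j → Dec (RuleOK rt h cs r j)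
  ruleOK? rt h cs (evo _ _ h')    j = h' ≟F h
  ruleOK? rt h cs (inR _ _ h')    j = child? (nth j cs)
    where
      child? : (m : Maybe AMem) → Dec (∃ λ c → m ≡ just c × labelA c ≡ h')
      child? nothing  = no λ { (_ , () , _) }
      child? (just c) = map′ (λ l → c , refl , l) (λ { (_ , refl , l) → l }) (labelA c ≟F h')
  ruleOK? rt h cs (outR _ _ h')   j = (h' ≟F h) ×-dec (rt ≟B false)
  ruleOK? rt h cs (divR _ _ _ h') j = (h' ≟F h) ×-dec ((rt ≟B false) ×-dec noChildren cs)
    where
      noChildren : (cs : List AMem) → Dec (cs ≡ [])
      noChildren []      = yes refl
      noChildren (_ ∷ _) = no λ ()

  actOK? : ∀ rt h cs x → Dec (ActOK rt h cs x)
  actOK? rt h cs (o , idle)    = yes tt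
  actOK? rt h cs (o , use r j) = (r ∈? rules) ×-dec ((objOf r ≟F o) ×-dec ruleOK? rt h cs r j)

  mutual
    valid? : ∀ rt a → Dec (Valid rt a)
    valid? rt (amem h xs cs) = all? (actOK? rt h cs) xs ×-dec validCs? xs 0 cs

    validCs? : ∀ xs j cs → Dec (ValidCs xs j cs)
    validCs? xs j []       = yes tt
    validCs? xs j (c ∷ cs) = (nIn j xs + subj c ≤? 1) ×-dec (valid? false c ×-dec validCs? xs (suc j) cs)

  -- Targets worth trying for rule r in a membrane with n children: a type (b)
  -- rule needs an existing child; for the other types any target will do.
  targets : ℕ → R → List ℕ
  targets n (inR _ _ _) = upTo n
  targets n _           = 0 ∷ []

  activationsWith : ℕ → O → R → List AObj
  activationsWith n o r = map (λ j → (o , use r j)) (targets n r)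

  activations : ℕ → O → List AObj
  activations n o = concatMap (activationsWith n o) rules

  activations-sound : ∀ n o {x} → x ∈ activations n o → Activate (o , idle) x
  activations-sound n o x∈ with find (∈-concatMap⁻ (activationsWith n o) {xs = rules} x∈)
  ... | r , _ , x∈r with ∈-map⁻ (λ j → (o , use r j)) x∈r
  ...   | j , _ , refl = act r j

  nth-< : ∀ {A : Set} j (cs : List A) {c} → nth j cs ≡ just c → j < length cs
  nth-< zero    (c ∷ cs) eq = s≤s z≤n
  nth-< (suc j) (c ∷ cs) eq = s≤s (nth-< j cs eq)

  activations-complete : ∀ {rt h cs o r j} → ActOK rt h cs (o , use r j) →
                         ∃ λ x → x ∈ activations (length cs) o × SameEffect (o , use r j) x
  activations-complete {cs = cs} {o} {r} {j} (r∈ , _ , applicable) with candidate r applicable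
    where
      candidate : ∀ r → RuleOK _ _ cs r j → ∃ λ x → x ∈ activationsWith (length cs) o r × SameEffect (o , use r j) x
      candidate (evo _ _ _)    _            = _ , here refl , retarget evo-irr
      candidate (inR _ _ _)    (_ , at , _) = _ , ∈-map⁺ _ (∈-upTo⁺ (nth-< j cs at)) , same
      candidate (outR _ _ _)   _            = _ , here refl , retarget outR-irr
      candidate (divR _ _ _ _) _            = _ , here refl , retarget divR-irr
  ... | x , x∈ , s = x , ∈-concatMap⁺ (activationsWith (length cs) o) (Any.map (λ { refl → x∈ }) r∈) , s

  activateHead : ℕ → AObj → List AObj → List (List AObj)
  activateHead n (o , idle)    xs = map (_∷ xs) (activations n o)
  activateHead n (_ , use _ _) xs = []

  activateOne : ℕ → List AObj → List (List AObj)
  activateOne n []       = []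
  activateOne n (x ∷ xs) = activateHead n x xs ++ map (x ∷_) (activateOne n xs)

  activateOne-sound : ∀ n xs {ys} → ys ∈ activateOne n xs → OneAt Activate xs ys
  activateOne-sound n (x ∷ xs) ys∈ with ∈-++⁻ (activateHead n x xs) ys∈
  activateOne-sound n ((o , idle) ∷ xs) _ | inj₁ ys∈ with ∈-map⁻ _ ys∈
  ... | _ , x∈ , refl = here (activations-sound n o x∈)
  activateOne-sound n (x ∷ xs) _ | inj₂ ys∈ with ∈-map⁻ _ ys∈
  ... | _ , zs∈ , refl = there (activateOne-sound n xs zs∈)

  activateOne-complete : ∀ {rt h cs xs ys} → OneAt Activate xs ys → All (ActOK rt h cs) ys →
                         ∃ λ ys' → ys' ∈ activateOne (length cs) xs × Retarget ys ys'
  activateOne-complete (here {xs = xs} (act r j)) (ok ∷ _) =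
    let (x , x∈ , s) = activations-complete ok in x ∷ xs , ∈-++⁺ˡ (∈-map⁺ _ x∈) , s ∷ Retarget-refl xs
  activateOne-complete {cs = cs} (there {x} {xs} step) (_ ∷ oks) =
    let (ys' , ys'∈ , rs) = activateOne-complete step oks
    in x ∷ ys' , ∈-++⁺ʳ (activateHead (length cs) x xs) (∈-map⁺ _ ys'∈) , same ∷ rs

  mutual
    extensions : AMem → List AMem
    extensions (amem h xs cs) =
      map (λ ys → amem h ys cs) (activateOne (length cs) xs) ++ map (amem h xs) (extensionsAt cs)

    extensionsAt : List AMem → List (List AMem)
    extensionsAt []       = []
    extensionsAt (c ∷ cs) = map (_∷ cs) (extensions c) ++ map (c ∷_) (extensionsAt cs)

  -- Every listed extension is an Extends-step, and every valid Extends-step is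
  -- listed up to Retarget (which does not affect validity).
  mutual
    extensions-sound : ∀ a {b} → b ∈ extensions a → Extends a b
    extensions-sound (amem h xs cs) b∈ with ∈-++⁻ (map (λ ys → amem h ys cs) (activateOne (length cs) xs)) b∈
    ... | inj₁ b∈' with ∈-map⁻ _ b∈'
    ...   | _ , ys∈ , refl = here (activateOne-sound (length cs) xs ys∈)
    extensions-sound (amem h xs cs) _ | inj₂ b∈' with ∈-map⁻ _ b∈'
    ...   | _ , ds∈ , refl = there (extensionsAt-sound cs ds∈)

    extensionsAt-sound : ∀ cs {ds} → ds ∈ extensionsAt cs → OneAt Extends cs ds
    extensionsAt-sound (c ∷ cs) ds∈ with ∈-++⁻ (map (_∷ cs) (extensions c)) ds∈
    ... | inj₁ ds∈' with ∈-map⁻ _ ds∈'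
    ...   | _ , d∈ , refl = here (extensions-sound c d∈)
    extensionsAt-sound (c ∷ cs) _ | inj₂ ds∈' with ∈-map⁻ _ ds∈'
    ...   | _ , ds∈ , refl = there (extensionsAt-sound cs ds∈)

  mutual
    extensions-complete : ∀ {rt a b} → Extends a b → Valid rt b → ∃ λ b' → b' ∈ extensions a × Lift Retarget b b'
    extensions-complete {a = amem h xs cs} (here step) (acts , _) =
      let (ys' , ys'∈ , rs) = activateOne-complete step acts
      in amem h ys' cs , ∈-++⁺ˡ (∈-map⁺ _ ys'∈) , node rs (LiftAll-refl cs)
    extensions-complete {a = amem h xs cs} (there steps) (_ , children) =
      let (ds' , ds'∈ , ts) = extensionsAt-complete steps children
      in amem h xs ds' , ∈-++⁺ʳ (map (λ ys → amem h ys cs) (activateOne (length cs) xs)) (∈-map⁺ _ ds'∈)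
                       , node (Retarget-refl xs) ts

    extensionsAt-complete : ∀ {xs j cs ds} → OneAt Extends cs ds → ValidCs xs j ds →
                            ∃ λ ds' → ds' ∈ extensionsAt cs × LiftAll Retarget ds ds'
    extensionsAt-complete (here {xs = cs} step) (_ , v , _) =
      let (d' , d'∈ , t) = extensions-complete step v in d' ∷ cs , ∈-++⁺ˡ (∈-map⁺ _ d'∈) , t ∷ LiftAll-refl cs
    extensionsAt-complete (there {c} {cs} steps) (_ , _ , vs) =
      let (ds' , ds'∈ , ts) = extensionsAt-complete steps vs
      in c ∷ ds' , ∈-++⁺ʳ (map (_∷ cs) (extensions c)) (∈-map⁺ _ ds'∈) , Lift-refl c ∷ ts

  step? : ∀ a → (∃ λ b → Extends a b × Valid true b) ⊎ Maximal a
  step? a with any? (valid? true) (extensions a)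
  ... | yes some = let (b , b∈ , vb) = find some in inj₁ (b , extensions-sound a b∈ , vb)
  ... | no none  = inj₂ λ b a→b vb →
    let (b' , b'∈ , t) = extensions-complete a→b vb in none (lose b'∈ (RetargetInvariance.valid t vb))

  -- The number of idle objects, which every activation lowers; this bounds the
  -- number of activations and makes the maximal search terminate.
  idleCount : List AObj → ℕ
  idleCount []                   = 0
  idleCount ((_ , idle) ∷ xs)    = suc (idleCount xs)
  idleCount ((_ , use _ _) ∷ xs) = idleCount xs

  mutual
    idleA : AMem → ℕ
    idleA (amem _ xs cs) = idleCount xs + idleAll cs

    idleAll : List AMem → ℕ
    idleAll []       = 0
    idleAll (c ∷ cs) = idleA c + idleAll cs

  idleCount-decreases : ∀ {xs ys} → OneAt Activate xs ys → idleCount ys < idleCount xs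
  idleCount-decreases (here (act r j))           = ≤-refl
  idleCount-decreases (there {_ , idle} step)    = s≤s (idleCount-decreases step)
  idleCount-decreases (there {_ , use _ _} step) = idleCount-decreases step

  mutual
    idleA-decreases : ∀ {a b} → Extends a b → idleA b < idleA a
    idleA-decreases (here {cs = cs} step)  = +-monoˡ-< (idleAll cs) (idleCount-decreases step)
    idleA-decreases (there {xs = xs} steps) = +-monoʳ-< (idleCount xs) (idleAll-decreases steps)

    idleAll-decreases : ∀ {cs ds} → OneAt Extends cs ds → idleAll ds < idleAll cs
    idleAll-decreases (here {xs = cs} step) = +-monoˡ-< (idleAll cs) (idleA-decreases step)
    idleAll-decreases (there {c} steps)     = +-monoʳ-< (idleA c) (idleAll-decreases steps)

  open MaximalSearch Extends (Valid true) idleA idleA-decreases step? using (maximal-above)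

  mutual
    erase-extends : ∀ {a b} → Extends a b → erase a ≡ erase b
    erase-extends (here {h} {cs = cs} step) = cong (λ os → mem h os (eraseList cs)) (objects step)
      where
        objects : ∀ {xs ys} → OneAt Activate xs ys → map proj₁ xs ≡ map proj₁ ys
        objects (here (act r j)) = refl
        objects (there {x} s)    = cong (proj₁ x ∷_) (objects s)
    erase-extends (there {h} {xs} steps) = cong (mem h (map proj₁ xs)) (eraseList-extends steps)

    eraseList-extends : ∀ {cs ds} → OneAt Extends cs ds → eraseList cs ≡ eraseList ds
    eraseList-extends (here {xs = cs} step) = cong (_∷ eraseList cs) (erase-extends step)
    eraseList-extends (there {c} steps)     = cong (erase c ∷_) (eraseList-extends steps)

  erase-reach : ∀ {a b} → Star Extends a b → erase a ≡ erase b
  erase-reach ε              = refl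
  erase-reach (step ◅ steps) = trans (erase-extends step) (erase-reach steps)

  ActiveIn : List AObj → List AObj → Set
  ActiveIn xs ys = All Active xs × xs ⊆ ys

  activeIn-activate : ∀ {xs ys ys'} → ActiveIn xs ys → OneAt Activate ys ys' → ActiveIn xs ys'
  activeIn-activate (acts , xs⊆ys) step = acts , λ x∈ → keeps step (All.lookup acts x∈) (xs⊆ys x∈)
    where
      keeps : ∀ {ys ys' x} → OneAt Activate ys ys' → Active x → x ∈ ys → x ∈ ys'
      keeps (here (act r j)) ()     (here refl)
      keeps (here _)         _      (there x∈) = there x∈
      keeps (there s)        _      (here refl) = here refl
      keeps (there s)        active (there x∈) = there (keeps s active x∈)

  mutual
    activeIn-extends : ∀ {a b b'} → Lift ActiveIn a b → Extends b b' → Lift ActiveIn a b'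
    activeIn-extends (node sub ts) (here step)  = node (activeIn-activate sub step) ts
    activeIn-extends (node sub ts) (there steps) = node sub (activeInAll-extends ts steps)

    activeInAll-extends : ∀ {cs ds ds'} → LiftAll ActiveIn cs ds → OneAt Extends ds ds' → LiftAll ActiveIn cs ds'
    activeInAll-extends (t ∷ ts) (here step)  = activeIn-extends t step ∷ ts
    activeInAll-extends (t ∷ ts) (there steps) = t ∷ activeInAll-extends ts steps

  activeIn-reach : ∀ {a b b'} → Lift ActiveIn a b → Star Extends b b' → Lift ActiveIn a b'
  activeIn-reach t ε              = t
  activeIn-reach t (step ◅ steps) = activeIn-reach (activeIn-extends t step) steps

  data Divides (u v : O) : AObj → Set where
    divides : ∀ {x o h k} → Divides u v (x , use (divR o u v h) k)

  divOf-just : ∀ xs {u v} → divOf xs ≡ just (u , v) → ∃ λ x → x ∈ xs × Divides u v x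
  divOf-just ((_ , use (divR _ _ _ _) _) ∷ xs) refl = _ , here refl , divides
  divOf-just ((_ , idle) ∷ xs)                 eq   = let (x , x∈ , d) = divOf-just xs eq in x , there x∈ , d
  divOf-just ((_ , use (evo _ _ _) _) ∷ xs)    eq   = let (x , x∈ , d) = divOf-just xs eq in x , there x∈ , d
  divOf-just ((_ , use (inR _ _ _) _) ∷ xs)    eq   = let (x , x∈ , d) = divOf-just xs eq in x , there x∈ , d
  divOf-just ((_ , use (outR _ _ _) _) ∷ xs)   eq   = let (x , x∈ , d) = divOf-just xs eq in x , there x∈ , d

  nOwn-positive : ∀ xs {u v x} → x ∈ xs → Divides u v x → 1 ≤ nOwn xs
  nOwn-positive (_ ∷ xs)                           (here refl) divides = s≤s z≤n
  nOwn-positive ((_ , idle) ∷ xs)                  (there x∈)  d       = nOwn-positive xs x∈ d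
  nOwn-positive ((_ , use (evo _ _ _) _) ∷ xs)     (there x∈)  d       = nOwn-positive xs x∈ d
  nOwn-positive ((_ , use (inR _ _ _) _) ∷ xs)     (there x∈)  d       = nOwn-positive xs x∈ d
  nOwn-positive ((_ , use (outR _ _ _) _) ∷ xs)    (there x∈)  d       = s≤s z≤n
  nOwn-positive ((_ , use (divR _ _ _ _) _) ∷ xs)  (there x∈)  d       = s≤s z≤n

  divOf-unique : ∀ xs {u v x} → nOwn xs ≤ 1 → x ∈ xs → Divides u v x → divOf xs ≡ just (u , v)
  divOf-unique (_ ∷ xs)                          _     (here refl) divides = refl
  divOf-unique ((_ , idle) ∷ xs)                 bound (there x∈)  d = divOf-unique xs bound x∈ d
  divOf-unique ((_ , use (evo _ _ _) _) ∷ xs)    bound (there x∈)  d = divOf-unique xs bound x∈ d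
  divOf-unique ((_ , use (inR _ _ _) _) ∷ xs)    bound (there x∈)  d = divOf-unique xs bound x∈ d
  divOf-unique ((_ , use (outR _ _ _) _) ∷ xs)   bound (there x∈)  d =
    ⊥-elim (n≮0 (≤-trans (nOwn-positive xs x∈ d) (≤-pred bound)))
  divOf-unique ((_ , use (divR _ _ _ _) _) ∷ xs) bound (there x∈)  d =
    ⊥-elim (n≮0 (≤-trans (nOwn-positive xs x∈ d) (≤-pred bound)))

  nOwn-root : ∀ {h cs} xs → All (ActOK true h cs) xs → nOwn xs ≡ 0
  nOwn-root []                                  []                      = refl
  nOwn-root ((_ , idle) ∷ xs)                   (_ ∷ oks)               = nOwn-root xs oks
  nOwn-root ((_ , use (evo _ _ _) _) ∷ xs)      (_ ∷ oks)               = nOwn-root xs oks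
  nOwn-root ((_ , use (inR _ _ _) _) ∷ xs)      (_ ∷ oks)               = nOwn-root xs oks
  nOwn-root ((_ , use (outR _ _ _) _) ∷ xs)     ((_ , _ , _ , ()) ∷ _)
  nOwn-root ((_ , use (divR _ _ _ _) _) ∷ xs)   ((_ , _ , _ , () , _) ∷ _)

  divOf-no-own : ∀ xs → nOwn xs ≡ 0 → divOf xs ≡ nothing
  divOf-no-own []                                 _  = refl
  divOf-no-own ((_ , idle) ∷ xs)                  eq = divOf-no-own xs eq
  divOf-no-own ((_ , use (evo _ _ _) _) ∷ xs)     eq = divOf-no-own xs eq
  divOf-no-own ((_ , use (inR _ _ _) _) ∷ xs)     eq = divOf-no-own xs eq
  divOf-no-own ((_ , use (outR _ _ _) _) ∷ xs)    ()
  divOf-no-own ((_ , use (divR _ _ _ _) _) ∷ xs)  ()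

  -- The membranes replacing a membrane: one copy, or two after division, whose
  -- contents differ only in the prefix contributed by the division rule.
  copies : Maybe (O × O) → List (List O)
  copies nothing        = [] ∷ []
  copies (just (u , v)) = (u ∷ []) ∷ (v ∷ []) ∷ []

  replicas : H → List O → List Mem → Maybe (O × O) → List Mem
  replicas h body cs d = map (λ pre → mem h (pre ++ body) cs) (copies d)

  apply-shape : ∀ inc h xs cs → apply inc (amem h xs cs) ≡
    (replicas h (evolved xs ++ proj₂ (applyCs xs 0 cs) ++ inc) (proj₁ (applyCs xs 0 cs)) (divOf xs) , outs xs)
  apply-shape inc h xs cs with applyCs xs 0 cs | divOf xs
  ... | _ | just _  = refl
  ... | _ | nothing = refl

  root-subject : ∀ a → Valid true a → subj a ≤ 1
  root-subject (amem h xs cs) (acts , _) = subst (_≤ 1) (sym (nOwn-root xs acts)) z≤n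

  root-single : ∀ a → Valid true a → ∃ λ C' → proj₁ (apply [] a) ≡ C' ∷ []
  root-single (amem h xs cs) (acts , _) =
    _ , trans (cong proj₁ (apply-shape [] h xs cs)) (cong (replicas h _ _) (divOf-no-own xs (nOwn-root xs acts)))

  mutual
    data Emb : Mem → Mem → Set where
      emb : ∀ {h os os' cs ds} → os ⊆ os' → Embeds cs ds → Emb (mem h os cs) (mem h os' ds)

    Embeds : List Mem → List Mem → Set
    Embeds ms ns = ∀ {m} → m ∈ ms → ∃ λ n → n ∈ ns × Emb m n

  mutual
    contains-emb : ∀ {m n o h} → Emb m n → Contains m o h → Contains n o h
    contains-emb (emb os⊆ _)  (here o∈)   = here (os⊆ o∈)
    contains-emb (emb _ embs) (there any) = there (containsAny-embeds embs any)

    containsAny-embeds : ∀ {cs ds o h} → Embeds cs ds →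
                         Any (λ c → Contains c o h) cs → Any (λ c → Contains c o h) ds
    containsAny-embeds embs (here c∋) = let (d , d∈ , e) = embs (here refl) in lose d∈ (contains-emb e c∋)
    containsAny-embeds embs (there any) = containsAny-embeds (λ c∈ → embs (there c∈)) any

  embeds-singleton : ∀ {ms ns m n} → ms ≡ m ∷ [] → ns ≡ n ∷ [] → Embeds ms ns → Emb m n
  embeds-singleton refl refl embeds with embeds (here refl)
  ... | _ , here refl , e = e

  embeds-++ : ∀ {ms ns ms' ns'} → Embeds ms ns → Embeds ms' ns' → Embeds (ms ++ ms') (ns ++ ns')
  embeds-++ {ms} {ns} f g m∈ with ∈-++⁻ ms m∈
  ... | inj₁ m∈ms  = let (n , n∈ , e) = f m∈ms in n , ∈-++⁺ˡ n∈ , e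
  ... | inj₂ m∈ms' = let (n , n∈ , e) = g m∈ms' in n , ∈-++⁺ʳ ns n∈ , e

  -- Each copy made for xs is dominated by a copy made for ys: either xs does
  -- not divide, or ys performs the very same division.
  copies-dominated : ∀ {xs ys} → ActiveIn xs ys → nOwn ys ≤ 1 →
                     ∀ {pre} → pre ∈ copies (divOf xs) → ∃ λ pre' → pre' ∈ copies (divOf ys) × pre ⊆ pre'
  copies-dominated {xs} {ys} (_ , xs⊆ys) bound pre∈ with divOf xs in eq
  ... | nothing with pre∈ | divOf ys
  ...   | here refl | nothing = _ , here refl , λ ()
  ...   | here refl | just _  = _ , here refl , λ ()
  copies-dominated {xs} {ys} (_ , xs⊆ys) bound pre∈ | just (u , v)
    with divOf-just xs eq
  ... | x , x∈ , d rewrite divOf-unique ys bound (xs⊆ys x∈) d = _ , pre∈ , λ y∈ → y∈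

  replicas-embed : ∀ {h d d' B B' K K'} → (∀ {pre} → pre ∈ copies d → ∃ λ pre' → pre' ∈ copies d' × pre ⊆ pre') →
                 B ⊆ B' → Embeds K K' →
                 Embeds (replicas h B K d) (replicas h B' K' d')
  replicas-embed dominated B⊆ K↪ m∈ with ∈-map⁻ _ m∈
  ... | _ , pre∈ , refl with dominated pre∈
  ...   | _ , pre'∈ , pre⊆ = _ , ∈-map⁺ _ pre'∈ , emb (++⁺ pre⊆ B⊆) K↪

  mutual
    apply-mono : ∀ {rt a b inc inc'} → Lift ActiveIn a b → Valid rt b → subj b ≤ 1 → inc ⊆ inc' →
                 Embeds (proj₁ (apply inc a)) (proj₁ (apply inc' b)) × proj₂ (apply inc a) ⊆ proj₂ (apply inc' b)
    apply-mono {a = amem h xs cs} {amem h ys ds} {inc} {inc'} (node sub ts) (_ , children) bound inc⊆ =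
        subst₂ Embeds (cong proj₁ (sym (apply-shape inc h xs cs))) (cong proj₁ (sym (apply-shape inc' h ys ds)))
          (replicas-embed (copies-dominated sub bound) body⊆ (proj₁ below))
      , subst₂ _⊆_ (cong proj₂ (sym (apply-shape inc h xs cs))) (cong proj₂ (sym (apply-shape inc' h ys ds)))
          (objectwise-mono outBy outs-concatMap (proj₂ sub))
      where
        below = applyCs-mono sub ts children
        body⊆ = ++⁺ (objectwise-mono evolvedBy evolved-concatMap (proj₂ sub)) (++⁺ (proj₂ below) inc⊆)

    applyCs-mono : ∀ {xs ys j cs ds} → ActiveIn xs ys → LiftAll ActiveIn cs ds → ValidCs ys j ds →
                   Embeds (proj₁ (applyCs xs j cs)) (proj₁ (applyCs ys j ds)) ×
                   proj₂ (applyCs xs j cs) ⊆ proj₂ (applyCs ys j ds)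
    applyCs-mono sub [] tt = (λ ()) , (λ ())
    applyCs-mono {xs} {ys} {j} {c ∷ cs} {d ∷ ds} sub (t ∷ ts) (bound , v , vs)
      with apply (incoming j xs) c | apply (incoming j ys) d | apply-mono t v (m+n≤o⇒n≤o (nIn j ys) bound)
             (objectwise-mono (incomingBy j) (incoming-concatMap j) (proj₂ sub))
         | applyCs xs (suc j) cs | applyCs ys (suc j) ds | applyCs-mono sub ts vs
    ... | _ | _ | (here↪ , up⊆) | _ | _ | (rest↪ , rest⊆) = embeds-++ here↪ rest↪ , ++⁺ up⊆ rest⊆

  markFirst : O → Act → List O → List AObj
  markFirst o t []       = []
  markFirst o t (x ∷ xs) with x ≟F o
  ... | yes _ = (x , t) ∷ map (tag idle) xs
  ... | no _  = (x , idle) ∷ markFirst o t xs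

  mutual
    annotate : List ℕ → O → Act → Mem → AMem
    annotate []      o t (mem h os cs) = amem h (markFirst o t os) (markList idle cs)
    annotate (j ∷ p) o t (mem h os cs) = amem h (map (tag idle) os) (annotateAt j p o t cs)

    annotateAt : ℕ → List ℕ → O → Act → List Mem → List AMem
    annotateAt _       _ _ _ []       = []
    annotateAt zero    p o t (c ∷ cs) = annotate p o t c ∷ markList idle cs
    annotateAt (suc j) p o t (c ∷ cs) = mark idle c ∷ annotateAt j p o t cs

  objects-tagged : ∀ t os → map proj₁ (map (tag t) os) ≡ os
  objects-tagged t os = trans (sym (map-∘ {g = proj₁} {f = tag t} os)) (map-id os)

  objects-markFirst : ∀ o t os → map proj₁ (markFirst o t os) ≡ os
  objects-markFirst o t []       = refl
  objects-markFirst o t (x ∷ xs) with x ≟F o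
  ... | yes _ = cong (x ∷_) (objects-tagged idle xs)
  ... | no _  = cong (x ∷_) (objects-markFirst o t xs)

  mutual
    erase-mark : ∀ t c → erase (mark t c) ≡ c
    erase-mark t (mem h os cs) = cong₂ (mem h) (objects-tagged t os) (erase-markList t cs)

    erase-markList : ∀ t cs → eraseList (markList t cs) ≡ cs
    erase-markList t []       = refl
    erase-markList t (c ∷ cs) = cong₂ _∷_ (erase-mark t c) (erase-markList t cs)

  mutual
    erase-annotate : ∀ p o t C → erase (annotate p o t C) ≡ C
    erase-annotate []      o t (mem h os cs) = cong₂ (mem h) (objects-markFirst o t os) (erase-markList idle cs)
    erase-annotate (j ∷ p) o t (mem h os cs) = cong₂ (mem h) (objects-tagged idle os) (erase-annotateAt j p o t cs)

    erase-annotateAt : ∀ j p o t cs → eraseList (annotateAt j p o t cs) ≡ cs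
    erase-annotateAt _       _ _ _ []       = refl
    erase-annotateAt zero    p o t (c ∷ cs) = cong₂ _∷_ (erase-annotate p o t c) (erase-markList idle cs)
    erase-annotateAt (suc j) p o t (c ∷ cs) = cong₂ _∷_ (erase-mark idle c) (erase-annotateAt j p o t cs)

  -- The stripped configuration, with the chosen instance active, relates to the
  -- annotation of C by adding idle objects; all its objects are active.
  ActiveAddIdle : List AObj → List AObj → Set
  ActiveAddIdle xs ys = All Active xs × AddIdle xs ys

  activeAddIdle⇒activeIn : ∀ {xs ys} → ActiveAddIdle xs ys → ActiveIn xs ys
  activeAddIdle⇒activeIn (acts , added) = acts , AddIdle-⊆ added

  idles-added : ∀ os → AddIdle [] (map (tag idle) os)
  idles-added []       = []
  idles-added (x ∷ os) = skip (idles-added os)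

  markFirst-added : ∀ o r j os → o ∈ os → ActiveAddIdle ((o , use r j) ∷ []) (markFirst o (use r j) os)
  markFirst-added o r j (x ∷ xs) o∈ with x ≟F o
  markFirst-added o r j (x ∷ xs) _          | yes refl = active ∷ [] , keep (idles-added xs)
  markFirst-added o r j (x ∷ xs) (here o≡x) | no x≢o   = ⊥-elim (x≢o (sym o≡x))
  markFirst-added o r j (x ∷ xs) (there o∈) | no _     =
    let (acts , added) = markFirst-added o r j xs o∈ in acts , skip added

  mutual
    clear-added : ∀ t c → Lift ActiveAddIdle (mark t (clear c)) (mark idle c)
    clear-added t (mem h os cs) = node ([] , idles-added os) (clearList-added t cs)

    clearList-added : ∀ t cs → LiftAll ActiveAddIdle (markList t (clearList cs)) (markList idle cs)
    clearList-added t []       = []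
    clearList-added t (c ∷ cs) = clear-added t c ∷ clearList-added t cs

  nodeAt-child : ∀ j p h os cs {m} → nodeAt (j ∷ p) (mem h os cs) ≡ just m →
                 ∃ λ c → nth j cs ≡ just c × nodeAt p c ≡ just m
  nodeAt-child j p h os cs at with nth j cs
  ... | just c = c , refl , at

  mutual
    strip-added : ∀ p o r j C {h os cs} → nodeAt p C ≡ just (mem h os cs) → o ∈ os →
                  Lift ActiveAddIdle (mark (use r j) (strip p o C)) (annotate p o (use r j) C)
    strip-added []      o r j (mem h os cs) refl o∈ = node (markFirst-added o r j os o∈) (clearList-added (use r j) cs)
    strip-added (k ∷ p) o r j (mem h os cs) at   o∈ =
      let (c , c-at , at') = nodeAt-child k p h os cs at in node ([] , idles-added os) (stripAt-added k p o r j cs c-at at' o∈)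

    stripAt-added : ∀ k p o r j cs {c h os cs'} → nth k cs ≡ just c → nodeAt p c ≡ just (mem h os cs') → o ∈ os →
                    LiftAll ActiveAddIdle (markList (use r j) (stripAt k p o cs)) (annotateAt k p o (use r j) cs)
    stripAt-added zero    p o r j (c ∷ cs) refl at o∈ = strip-added p o r j c at o∈ ∷ clearList-added (use r j) cs
    stripAt-added (suc k) p o r j (c ∷ cs) c-at at o∈ = clear-added (use r j) c ∷ stripAt-added k p o r j cs c-at at o∈

  -- Lemma 12 inside a fixed system.
  step-realising : (C : Mem) (p : List ℕ) (o : O) (h : H) → OccursAt C p o h →
    (r : R) (o' : O) (h' : H) →
    (∃ λ j → ∃ λ D' → ApplyRule r j (strip p o C) D' × Contains D' o' h') →
    ∃ λ C' → Step C C' × Contains C' o' h'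
  step-realising C p o h (_ , _ , at , o∈) r o' h' (j , D' , (valid-D , applied-D) , D'∋o')
    with maximal-above _ (AddIdleInvariance.valid (Lift-map proj₂ (strip-added p o r j C at o∈)) valid-D)
  ... | a* , a₀⇝*a* , valid-a* , maximal-a* with root-single a* valid-a*
  ...   | C' , applied-C = C' , (a* , erase-a* , valid-a* , maximal-a* , applied-C) , contains-emb D'↪C' D'∋o'
    where
      erase-a* : erase a* ≡ C
      erase-a* = trans (sym (erase-reach a₀⇝*a*)) (erase-annotate p o (use r j) C)

      stripped⊑a* : Lift ActiveIn (mark (use r j) (strip p o C)) a*
      stripped⊑a* = activeIn-reach (Lift-map activeAddIdle⇒activeIn (strip-added p o r j C at o∈)) a₀⇝*a*

      D'↪C' : Emb D' C'
      D'↪C' = embeds-singleton applied-D applied-C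
                (proj₁ (apply-mono stripped⊑a* valid-a* (root-subject a* valid-a*) (λ ())))

lemma12 : (Π : System) → let open Sem Π in
    (C : Mem) → label C ≡ System.env Π →
    (p : List ℕ) (o : O) (h : H) → OccursAt C p o h →
    (r : R) → r ∈ System.rules Π →
    (o' : O) (h' : H) →
    (∃ λ j → ∃ λ D' → ApplyRule r j (strip p o C) D' × Contains D' o' h') →
    ∃ λ C' → Step C C' × Contains C' o' h'
lemma12 Π C _ p o h occ r _ o' h' = Development.step-realising Π C p o h occ r o' h'
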